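{- Let $b\ge2$, let $\mathcal{A}\subset\{0,\dots,b-1\}$ and $\mathcal{C}=\{\sum_{i=0}^{N}n_ib^i : n_i\in\mathcal{A},\ N\in\mathbb{N}_0\}$, and suppose $1\in\mathcal{C}$. For an integer $m\ge1$ and $t\in\mathbb{Z}/m\mathbb{Z}$ define $\kappa_{m,t}$ as follows: write $m=uv$ with $(v,b)=1$ and every prime dividing $u$ dividing $b$, let $L$ be a positive integer with $u\mid b^L$, let $h\in\mathbb{Z}$ satisfy $bh\equiv1\pmod v$, let $s=b-|\mathcal{A}|$, and $$\kappa_{m,t}:=\frac{b}{(b-s)^L\phi(bv)}\sum_{\substack{0\le n<b^L\\ n\equiv t\ (\mathrm{mod}\ u)}}\mathbf{1}_{\mathcal{C}}(n)\,\mathbf{1}\big((bht+(1-bh)n,\,bv)=1\big).$$ Then $\kappa_{m,1}>0$ for every integer $m\ge1$.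
   Context: $\phi$ is Euler's totient function; $\mathbf{1}_{\mathcal{C}}$ is the indicator of $\mathcal{C}$. -}

module Defs where

open import Data.Nat as ℕ using (ℕ; zero; suc; _^_; _∸_)
open import Data.Nat.GCD using (gcd)
open import Data.Integer as ℤ using (ℤ; +_)
open import Data.Integer.Divisibility.Signed using (_∣_; _∣?_)
open import Data.Fin using (Fin; toℕ)
open import Data.Fin.Subset using (Subset; _∈_; ∣_∣)
open import Data.List using (List; []; _∷_; length; filter; upTo)
open import Data.List.Relation.Unary.All using (All)
open import Data.Product using (Σ; _×_)
open import Data.Rational as ℚ using (ℚ; 0ℚ)
open import Relation.Nullary using (Dec)
open import Relation.Nullary.Decidable using (_×-dec_)
open import Relation.Binary.PropositionalEquality using (_≡_)

digitValue : {b : ℕ} → List (Fin b) → ℕ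
digitValue [] = 0
digitValue {b} (d ∷ ds) = toℕ d ℕ.+ b ℕ.* digitValue ds

-- n ∈ 𝒞 : n = Σ_{i=0}^{N} n_i b^i for some N ≥ 0 (at least one digit) with all n_i ∈ 𝒜
InC : {b : ℕ} → Subset b → ℕ → Set
InC {b} A n = Σ (Fin b) λ d → Σ (List (Fin b)) λ ds →
  All (_∈ A) (d ∷ ds) × (digitValue (d ∷ ds) ≡ n)

φ : ℕ → ℕ
φ n = length (filter (λ k → gcd (suc k) n ℕ.≟ 1) (upTo n))

-- rational p / q, with the convention p/0 = 0 (never triggered under the
-- hypotheses, since 1 ∈ 𝒞 forces |𝒜| ≥ 1 and φ(bv) ≥ 1)
frac : ℤ → ℕ → ℚ
frac p zero = 0ℚ
frac p (suc q) = p ℚ./ suc q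

lin : (b : ℕ) (h t : ℤ) (n : ℕ) → ℤ
lin b h t n = (+ b) ℤ.* h ℤ.* t ℤ.+ (ℤ.1ℤ ℤ.- (+ b) ℤ.* h) ℤ.* (+ n)

condκ : (b u v : ℕ) (h t : ℤ) (n : ℕ) → Set
condκ b u v h t n = ((+ u) ∣ ((+ n) ℤ.- t)) × (gcd ℤ.∣ lin b h t n ∣ (b ℕ.* v) ≡ 1)

condκ? : (b u v : ℕ) (h t : ℤ) (n : ℕ) → Dec (condκ b u v h t n)
condκ? b u v h t n = ((+ u) ∣? ((+ n) ℤ.- t)) ×-dec (gcd ℤ.∣ lin b h t n ∣ (b ℕ.* v) ℕ.≟ 1)

-- Σ_{0 ≤ n < b^L, n ≡ t (mod u)} 1_𝒞(n) · 1((bht+(1-bh)n, bv) = 1)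
-- dec : any decision procedure for membership in 𝒞 (all agree extensionally)
κsum : {b : ℕ} (A : Subset b) (dec : ∀ n → Dec (InC A n))
       (u v L : ℕ) (h t : ℤ) → ℕ
κsum {b} A dec u v L h t =
  length (filter (λ n → dec n ×-dec condκ? b u v h t n) (upTo (b ^ L)))

-- κ_{m,t} = b / ((b - s)^L φ(b v)) · κsum,   s = b - |𝒜|
κ : {b : ℕ} (A : Subset b) (dec : ∀ n → Dec (InC A n))
    (u v L : ℕ) (h t : ℤ) → ℚ
κ {b} A dec u v L h t =
  frac (+ b) ((b ∸ (b ∸ ∣ A ∣)) ^ L ℕ.* φ (b ℕ.* v)) ℚ.* ((+ κsum A dec u v L h t) ℚ./ 1)

-- Only the term n = 1 of the sum is needed: 1 ∈ 𝒞 by hypothesis, 1 ≡ 1 (mod u),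
-- and at n = t the linear form b h t + (1 - b h) n collapses to t = 1, which is
-- coprime to b v.  The prefactor is positive because 𝒜 contains the digits of 1
-- (so b - s = |𝒜| ≥ 1) and φ(b v) ≥ 1.

module Submission where

open import Defs
open import Data.Nat using (ℕ; _≥_; _*_; _^_)
open import Data.Nat.Divisibility using (_∣_)
open import Data.Nat.Coprimality using (Coprime)
open import Data.Nat.Primality using (Prime)
open import Data.Integer as ℤ using (ℤ; +_)
open import Data.Integer.Divisibility.Signed using () renaming (_∣_ to _∣ℤ_)
open import Data.Fin.Subset using (Subset)
open import Data.Rational using (0ℚ; _<_)
open import Relation.Nullary using (Dec)
open import Relation.Binary.PropositionalEquality using (_≡_)

open import Data.Nat as ℕ using (suc; _∸_; z<s; >-nonZero; >-nonZero⁻¹)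
open import Data.Nat.Properties as ℕ using (m∸[m∸n]≡n; *-mono-<; m^n>0; ^-monoʳ-<; m*n≢0⇒n≢0)
open import Data.Integer.Divisibility.Signed using (divides)
open import Data.Integer.Properties using (*-zeroˡ)
open import Data.Integer.Tactic.RingSolver using (solve-∀)
open import Data.Nat.GCD using (gcd; gcd-zeroˡ)
import Data.Rational as ℚ
open import Data.Rational.Properties using (positive⁻¹; pos*pos⇒pos; normalize-pos)
open import Data.List using (List; filter; length)
open import Data.List.Properties using (filter-some)
open import Data.List.Relation.Unary.Any as Any using ()
open import Data.List.Relation.Unary.All using (head)
open import Data.List.Membership.Propositional using (_∈_)
open import Data.List.Membership.Propositional.Properties using (∈-upTo⁺)
open import Data.Fin.Subset using (∣_∣)
open import Data.Fin.Subset.Properties using (∣p∣≤n; x∈p⇒∣p-x∣<∣p∣)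
open import Data.Product using (_,_)
open import Relation.Unary using (Pred; Decidable)
open import Relation.Binary.PropositionalEquality using (refl; sym; subst)

length-filter-pos : ∀ {a p} {A : Set a} {P : Pred A p} (P? : Decidable P) {x : A} {xs : List A} →
                    x ∈ xs → P x → 0 ℕ.< length (filter P? xs)
length-filter-pos P? x∈xs px = filter-some P? (Any.map (λ { refl → px }) x∈xs)

φ-pos : ∀ {n} → 0 ℕ.< n → 0 ℕ.< φ n
φ-pos {suc n} _ = length-filter-pos (λ k → gcd (suc k) (suc n) ℕ.≟ 1) (∈-upTo⁺ z<s) (gcd-zeroˡ (suc n))

InC⇒∣A∣>0 : ∀ {b} {A : Subset b} {n} → InC A n → 0 ℕ.< ∣ A ∣
InC⇒∣A∣>0 (_ , _ , digits∈A , _) = ℕ.m<n⇒0<n (x∈p⇒∣p-x∣<∣p∣ (head digits∈A))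

frac*-pos : ∀ {p q k} → 0 ℕ.< p → 0 ℕ.< q → 0 ℕ.< k → 0ℚ < frac (+ p) q ℚ.* ((+ k) ℚ./ 1)
frac*-pos {suc p} {suc q} {suc k} _ _ _ =
  positive⁻¹ (p/q ℚ.* k/1) {{pos*pos⇒pos p/q {{normalize-pos (suc p) (suc q)}} k/1 {{normalize-pos (suc k) 1}}}}
  where
  p/q k/1 : ℚ.ℚ
  p/q = frac (+ suc p) (suc q)
  k/1 = (+ suc k) ℚ./ 1

lin-diagonal : ∀ b h n → lin b h (+ n) n ≡ + n
lin-diagonal b h n = convex-fixed ((+ b) ℤ.* h) (+ n)
  where
  convex-fixed : ∀ x t → x ℤ.* t ℤ.+ (ℤ.1ℤ ℤ.- x) ℤ.* t ≡ t
  convex-fixed = solve-∀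

condκ-at-1 : ∀ b u v h → condκ b u v h ℤ.1ℤ 1
condκ-at-1 b u v h =
  divides (+ 0) (sym (*-zeroˡ (+ u))) ,
  subst (λ z → gcd ℤ.∣ z ∣ (b * v) ≡ 1) (sym (lin-diagonal b h 1)) (gcd-zeroˡ (b * v))

κsum-at-1-pos : ∀ {b} (A : Subset b) dec u v L h → InC A 1 → 1 ℕ.< b ^ L →
                0 ℕ.< κsum A dec u v L h ℤ.1ℤ
κsum-at-1-pos {b} A dec u v L h 1∈C 1<b^L =
  length-filter-pos _ (∈-upTo⁺ 1<b^L) (1∈C , condκ-at-1 b u v h)

*-pos⇒pos-right : ∀ u {v} → 0 ℕ.< u * v → 0 ℕ.< v
*-pos⇒pos-right u {v} 0<uv = >-nonZero⁻¹ v {{m*n≢0⇒n≢0 u {{>-nonZero 0<uv}}}}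

corollary1p4 : (b : ℕ) → b ≥ 2 → (A : Subset b) → (dec : ∀ n → Dec (InC A n)) →
    InC A 1 →
    (m : ℕ) → m ≥ 1 →
    (u v : ℕ) → m ≡ u * v → Coprime v b → (∀ p → Prime p → p ∣ u → p ∣ b) →
    (L : ℕ) → L ≥ 1 → u ∣ b ^ L →
    (h : ℤ) → (+ v) ∣ℤ ((+ b) ℤ.* h ℤ.- ℤ.1ℤ) →
    0ℚ < κ A dec u v L h ℤ.1ℤ
corollary1p4 b b≥2 A dec 1∈C m m≥1 u v refl _ _ L L≥1 _ h _ =
  frac*-pos 0<b (*-mono-< 0<∣A∣ᴸ (φ-pos (*-mono-< 0<b 0<v)))
                (κsum-at-1-pos A dec u v L h 1∈C (^-monoʳ-< b b≥2 L≥1))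
  where
  0<b : 0 ℕ.< b
  0<b = ℕ.m<n⇒0<n b≥2
  0<v : 0 ℕ.< v
  0<v = *-pos⇒pos-right u m≥1
  0<∣A∣ᴸ : 0 ℕ.< (b ∸ (b ∸ ∣ A ∣)) ^ L
  0<∣A∣ᴸ rewrite m∸[m∸n]≡n (∣p∣≤n A) = m^n>0 ∣ A ∣ {{>-nonZero (InC⇒∣A∣>0 1∈C)}} L
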